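{- Let \(k, \ell \in \mathbb{Z}_{\ge 2}\) be multiplicatively independent. Consider a finite system of strict linear homogeneous inequalities in two variables \(x\) and \(y\) with coefficients in \(\mathbb{Q}\) (i.e. inequalities of the form \(ax + by > 0\) with \(a, b \in \mathbb{Q}\)). If this system has a solution \((u,v) \in \mathbb{R}_{>0}^2\), then it also has infinitely many solutions \((u,v) \in k^{\mathbb{N}} \times \ell^{\mathbb{N}}\).
   Context: \(\mathbb{N} = \{0,1,2,\dots\}\), and \(k^{\mathbb{N}} = \{k^n : n \in \mathbb{N}\}\). Two integers \(k, \ell \ge 2\) are multiplicatively independent if there are no positive integers \(a, b\) with \(k^a = \ell^b\).
   Formalization: The positive solution (u,v) assumed to exist has rational coordinates instead of real ones. -}

module Defs where

open import Data.Nat as ℕ using (ℕ; _^_; _≤_)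
open import Data.Integer using (+_)
open import Data.Rational using (ℚ; _/_; _+_; _*_; _<_; 0ℚ)
open import Data.Product using (_×_; _,_)
open import Data.List using (List)
open import Data.List.Relation.Unary.All using (All)
open import Relation.Binary.PropositionalEquality using (_≢_)

MultIndep : ℕ → ℕ → Set
MultIndep k ℓ = ∀ (a b : ℕ) → 1 ≤ a → 1 ≤ b → k ^ a ≢ ℓ ^ b

toℚ : ℕ → ℚ
toℚ n = + n / 1

Ineq : Set
Ineq = ℚ × ℚ

Satisfies : Ineq → ℚ → ℚ → Set
Satisfies (a , b) x y = 0ℚ < a * x + b * y

Solves : List Ineq → ℚ → ℚ → Set
Solves sys x y = All (λ c → Satisfies c x y) sys

{-# OPTIONS --safe #-}
module Submission where

-- Clearing denominators turns every constraint into A x + B y > 0 with A, B ∈ ℤ, and the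
-- positive solution into a point (U , V) ∈ ℕ² with A U + B V ≥ 1.  If N exceeds every ∣ B ∣,
-- all directions between (U , V) and (N U , N V + 1) solve the system, so it suffices to find
-- ℓⁿ / kᵐ in the open interval of slopes between them, with m + n arbitrarily large.
-- Scaling ℓ⁰, …, ℓᵀ into [1, k) by powers of k and applying the pigeonhole principle gives
-- some ℓᵃ / kᵇ arbitrarily close to 1, and different from 1 by multiplicative independence.
-- The powers of this ratio or of its inverse, started from a large power of k or of ℓ, cross
-- the interval in steps too small to miss it.

module Density where

  open import Data.Nat.Base
    using (ℕ; zero; suc; _+_; _*_; _∸_; _^_; _≤_; _<_; >-nonZero; z≤n; s≤s)
  open import Data.Nat.Properties
  open import Data.Nat.Tactic.RingSolver using (solve-∀)
  open import Algebra.Properties.CommutativeSemigroup *-commutativeSemigroup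
    using (x∙yz≈y∙xz; xy∙z≈y∙xz; xy∙z≈xz∙y)
  open import Data.Fin.Base using (toℕ; fromℕ<)
  open import Data.Fin.Properties using (pigeonhole; fromℕ<-injective)
  open import Data.Product.Base using (∃; ∃₂; _×_; _,_)
  open import Relation.Nullary using (¬_; yes; no; contradiction)
  open import Relation.Unary using (Pred; Decidable)
  open import Relation.Binary.Definitions using (tri<; tri≈; tri>)
  open import Relation.Binary.PropositionalEquality
  open import Defs using (MultIndep)

  crossing : ∀ {p} {P : Pred ℕ p} → Decidable P → P 0 → ∀ N → ¬ P N →
             ∃ λ t → t < N × P t × ¬ P (suc t)
  crossing P? P0 zero ¬PN = contradiction P0 ¬PN
  crossing P? P0 (suc N) ¬PN+1 with P? N
  ... | yes PN = N , ≤-refl , PN , ¬PN+1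
  ... | no ¬PN with t , t<N , Pt , ¬Pt+1 ← crossing P? P0 N ¬PN =
    t , m<n⇒m<1+n t<N , Pt , ¬Pt+1

  -- Bernoulli's inequality (1 + 1/x)ⁿ ≥ 1 + n/x, multiplied through by xⁿ⁺¹.
  bernoulli : ∀ x n → x ^ n * (x + n) ≤ x * suc x ^ n
  bernoulli x zero =
    ≤-reflexive (trans (*-identityˡ (x + 0)) (trans (+-identityʳ x) (sym (*-identityʳ x))))
  bernoulli x (suc n) = begin
    x ^ suc n * (x + suc n)                ≤⟨ m≤m+n _ (x ^ n * n) ⟩
    x * x ^ n * (x + suc n) + x ^ n * n    ≡⟨ regroup x (x ^ n) n ⟩
    suc x * (x ^ n * (x + n))              ≤⟨ *-monoʳ-≤ (suc x) (bernoulli x n) ⟩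
    suc x * (x * suc x ^ n)                ≡⟨ x∙yz≈y∙xz (suc x) x (suc x ^ n) ⟩
    x * suc x ^ suc n                      ∎
    where
      open ≤-Reasoning
      regroup : ∀ x y n → x * y * (x + suc n) + y * n ≡ suc x * (y * (x + n))
      regroup = solve-∀

  -- T = c r turns Bernoulli into (1 + 1/r)ᵀ ≥ 1 + c.
  ^-outgrows-* : ∀ {r s} → 0 < r → r < s → ∀ c → ∃ λ T → c * r ^ T < s ^ T
  ^-outgrows-* {r@(suc _)} {s} _ r<s c = T , (begin-strict
    c * r ^ T        <⟨ m<n+m (c * r ^ T) (m^n>0 r T) ⟩
    suc c * r ^ T    ≡⟨ *-comm (suc c) (r ^ T) ⟩
    r ^ T * suc c    ≤⟨ *-cancelˡ-≤ r rᵀ⁺¹[1+c]≤r[1+r]ᵀ ⟩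
    suc r ^ T        ≤⟨ ^-monoˡ-≤ T r<s ⟩
    s ^ T            ∎)
    where
      open ≤-Reasoning
      T = c * r
      regroup : ∀ r y c → r * (y * suc c) ≡ y * (r + c * r)
      regroup = solve-∀
      rᵀ⁺¹[1+c]≤r[1+r]ᵀ : r * (r ^ T * suc c) ≤ r * suc r ^ T
      rᵀ⁺¹[1+c]≤r[1+r]ᵀ = ≤-trans (≤-reflexive (regroup r (r ^ T) c)) (bernoulli r T)

  n<m^n : ∀ {m} → 1 < m → ∀ n → n < m ^ n
  n<m^n 1<m zero = s≤s z≤n
  n<m^n {m@(suc _)} 1<m (suc n) = begin-strict
    suc n       ≤⟨ n<m^n 1<m n ⟩
    m ^ n       <⟨ m<m*n (m ^ n) m {{m^n≢0 m n}} 1<m ⟩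
    m ^ n * m   ≡⟨ *-comm (m ^ n) m ⟩
    m ^ suc n   ∎
    where open ≤-Reasoning

  ⌊log⌋ : ∀ {k x} → 1 < k → 0 < x → ∃ λ m → k ^ m ≤ x × x < k ^ suc m
  ⌊log⌋ {k} {x} 1<k 0<x
    with m , _ , kᵐ≤x , kᵐ⁺¹≰x ← crossing (λ m → k ^ m ≤? x) 0<x x (<⇒≱ (n<m^n 1<k x))
    = m , kᵐ≤x , ≰⇒> kᵐ⁺¹≰x

  ⌊log⌋-mono : ∀ {k m₁ m₂ x₁ x₂} → 1 < k →
    k ^ m₁ ≤ x₁ → x₂ < k ^ suc m₂ → x₁ ≤ x₂ → m₁ ≤ m₂
  ⌊log⌋-mono {k@(suc _)} {m₁} {m₂} {x₁} {x₂} _ kᵐ¹≤x₁ x₂<kᵐ²⁺¹ x₁≤x₂ =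
    ≮⇒≥ λ m₂<m₁ → <-irrefl refl (begin-strict
      k ^ suc m₂   ≤⟨ ^-monoʳ-≤ k m₂<m₁ ⟩
      k ^ m₁       ≤⟨ kᵐ¹≤x₁ ⟩
      x₁           ≤⟨ x₁≤x₂ ⟩
      x₂           <⟨ x₂<kᵐ²⁺¹ ⟩
      k ^ suc m₂   ∎)
    where open ≤-Reasoning

  ^-split : ∀ x {i j} → i ≤ j → x ^ j ≡ x ^ i * x ^ (j ∸ i)
  ^-split x {i} {j} i≤j =
    trans (cong (x ^_) (sym (m+[n∸m]≡n i≤j))) (^-distribˡ-+-* x i (j ∸ i))

  -- N / D lies in the t-th of the intervals [ρᵗ, ρᵗ⁺¹), ρ = s / r.
  record InBucket (r s t N D : ℕ) : Set where
    constructor in-bucket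
    field
      lower : s ^ t * D ≤ N * r ^ t
      upper : N * r ^ suc t < s ^ suc t * D

  bucket : ∀ {k r s T N D} → k * r ^ T < s ^ T → D ≤ N → N < k * D →
           ∃ λ t → t < T × InBucket r s t N D
  bucket {k} {r} {s} {T} {N} {D} k<ρᵀ D≤N N<kD =
    let t , t<T , lower , ¬upper = crossing (λ t → s ^ t * D ≤? N * r ^ t) start T beyond
    in t , t<T , in-bucket lower (≰⇒> ¬upper)
    where
      start : 1 * D ≤ N * 1
      start = subst₂ _≤_ (sym (*-identityˡ D)) (sym (*-identityʳ N)) D≤N
      beyond : ¬ (s ^ T * D ≤ N * r ^ T)
      beyond = <⇒≱ (begin-strict
        N * r ^ T         ≤⟨ *-monoˡ-≤ (r ^ T) (<⇒≤ N<kD) ⟩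
        k * D * r ^ T     ≡⟨ xy∙z≈y∙xz k D (r ^ T) ⟩
        D * (k * r ^ T)   <⟨ *-monoʳ-< D {{D≢0}} k<ρᵀ ⟩
        D * s ^ T         ≡⟨ *-comm D (s ^ T) ⟩
        s ^ T * D         ∎)
        where
          open ≤-Reasoning
          D≢0 = m*n≢0⇒n≢0 k {{>-nonZero (≤-<-trans z≤n N<kD)}}

  bucket-ratio-< : ∀ {r s t N₁ D₁ N₂ D₂} → 0 < D₁ →
    InBucket r s t N₁ D₁ → InBucket r s t N₂ D₂ → N₂ * D₁ * r < N₁ * D₂ * s
  bucket-ratio-< {r} {s} {t} {N₁} {D₁} {N₂} {D₂} 0<D₁ (in-bucket lower _) (in-bucket _ upper) =
    *-cancelʳ-< (r ^ t) _ _ (begin-strict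
      N₂ * D₁ * r * r ^ t        ≡⟨ regroup₁ N₂ D₁ r (r ^ t) ⟩
      N₂ * r ^ suc t * D₁        <⟨ *-monoˡ-< D₁ {{>-nonZero 0<D₁}} upper ⟩
      s ^ suc t * D₂ * D₁        ≡⟨ regroup₂ s (s ^ t) D₂ D₁ ⟩
      s ^ t * D₁ * (s * D₂)      ≤⟨ *-monoˡ-≤ (s * D₂) lower ⟩
      N₁ * r ^ t * (s * D₂)      ≡⟨ regroup₃ N₁ (r ^ t) s D₂ ⟩
      N₁ * D₂ * s * r ^ t        ∎)
    where
      open ≤-Reasoning
      regroup₁ : ∀ n d r b → n * d * r * b ≡ n * (r * b) * d
      regroup₁ = solve-∀
      regroup₂ : ∀ s a e d → s * a * e * d ≡ a * d * (s * e)
      regroup₂ = solve-∀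
      regroup₃ : ∀ n b s e → n * b * (s * e) ≡ n * e * s * b
      regroup₃ = solve-∀

  same-bucket⇒close : ∀ {r s t N D L K} → 0 < D → 0 < K →
    InBucket r s t N D → InBucket r s t (N * L) (D * K) → L * r < K * s × K * r < L * s
  same-bucket⇒close {r} {s} {t} {N} {D} {L} {K} 0<D 0<K bucket₁ bucket₂ =
      *-cancelˡ-< (N * D) _ _ (subst₂ _<_ (split-L N L D r) (split-K N D K s)
        (bucket-ratio-< 0<D bucket₁ bucket₂)) ,
      *-cancelˡ-< (N * D) _ _ (subst₂ _<_ (split-K N D K r) (split-L N L D s)
        (bucket-ratio-< (*-mono-< 0<D 0<K) bucket₂ bucket₁))
    where
      split-L : ∀ n l d x → n * l * d * x ≡ n * d * (l * x)
      split-L = solve-∀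
      split-K : ∀ n d k x → n * (d * k) * x ≡ n * d * (k * x)
      split-K = solve-∀

  same-bucket-powers : ∀ {k ℓ r s t i j mᵢ mⱼ} → 1 < k → 1 < ℓ → i < j →
    k ^ mᵢ ≤ ℓ ^ i → ℓ ^ j < k ^ suc mⱼ →
    InBucket r s t (ℓ ^ i) (k ^ mᵢ) → InBucket r s t (ℓ ^ j) (k ^ mⱼ) →
    ∃₂ λ a b → 0 < a × ℓ ^ a * r < k ^ b * s × k ^ b * r < ℓ ^ a * s
  same-bucket-powers {k@(suc _)} {ℓ@(suc _)} {r} {s} {t} {i} {j} {mᵢ} {mⱼ}
                     1<k 1<ℓ i<j kᵐⁱ≤ℓⁱ ℓʲ<kᵐʲ⁺¹ bucketᵢ bucketⱼ =
    j ∸ i , mⱼ ∸ mᵢ , m<n⇒0<n∸m i<j ,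
    same-bucket⇒close (m^n>0 k mᵢ) (m^n>0 k (mⱼ ∸ mᵢ)) bucketᵢ
      (subst₂ (InBucket r s t) (^-split ℓ (<⇒≤ i<j)) (^-split k mᵢ≤mⱼ) bucketⱼ)
    where
      mᵢ≤mⱼ : mᵢ ≤ mⱼ
      mᵢ≤mⱼ = ⌊log⌋-mono 1<k kᵐⁱ≤ℓⁱ ℓʲ<kᵐʲ⁺¹ (^-monoʳ-≤ ℓ (<⇒≤ i<j))

  -- Pigeonhole over ℓ⁰, …, ℓᵀ, each scaled into [1, k) by a power of k.
  close-powers : ∀ {k ℓ r s T} → 1 < k → 1 < ℓ → k * r ^ T < s ^ T →
    ∃₂ λ a b → 0 < a × ℓ ^ a * r < k ^ b * s × k ^ b * r < ℓ ^ a * s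
  close-powers {k} {ℓ@(suc _)} {r} {s} {T} 1<k 1<ℓ k<ρᵀ =
    let i , j , i<j , same = pigeonhole (n<1+n T) bucket-of
        mᵢ , tᵢ , _ , (kᵐⁱ≤ℓⁱ , _) , bucketᵢ = place (toℕ i)
        mⱼ , tⱼ , _ , (_ , ℓʲ<kᵐʲ⁺¹) , bucketⱼ = place (toℕ j)
        tⱼ≡tᵢ = fromℕ<-injective tⱼ tᵢ _ _ (sym same)
    in same-bucket-powers {t = tᵢ} {mᵢ = mᵢ} {mⱼ = mⱼ} 1<k 1<ℓ i<j kᵐⁱ≤ℓⁱ ℓʲ<kᵐʲ⁺¹ bucketᵢ
         (subst (λ t → InBucket r s t (ℓ ^ toℕ j) (k ^ mⱼ)) tⱼ≡tᵢ bucketⱼ)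
    where
      place : ∀ i → ∃₂ λ m t → t < T × (k ^ m ≤ ℓ ^ i × ℓ ^ i < k ^ suc m) ×
                                InBucket r s t (ℓ ^ i) (k ^ m)
      place i = let m , kᵐ≤ℓⁱ , ℓⁱ<kᵐ⁺¹ = ⌊log⌋ 1<k (m^n>0 ℓ i)
                    t , t<T , inBucket = bucket {k = k} k<ρᵀ kᵐ≤ℓⁱ ℓⁱ<kᵐ⁺¹
                in m , t , t<T , (kᵐ≤ℓⁱ , ℓⁱ<kᵐ⁺¹) , inBucket
      bucket-of = λ i → let _ , _ , t<T , _ = place (toℕ i) in fromℕ< t<T

  -- The ratios Lʲ / (c Kʲ) start at or below p / q and grow by the factor L / K,
  -- which is smaller than the width (P / Q) / (p / q): one of them lands in (p / q, P / Q).
  orbit-enters : ∀ {K L c p q P Q} → 0 < K → K < L → 0 < c → 0 < q → q ≤ c * p →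
    L * (p * Q) < K * (P * q) →
    ∃ λ j → c * K ^ j * p < L ^ j * q × L ^ j * Q < c * K ^ j * P
  orbit-enters {K@(suc _)} {L} {c@(suc _)} {p} {q@(suc _)} {P} {Q}
               0<K K<L 0<c 0<q q≤cp LpQ<KPq =
    let T , cpKᵀ<Lᵀ = ^-outgrows-* 0<K K<L (c * p)
        t , _ , below , ¬below =
          crossing (λ j → L ^ j * q ≤? c * K ^ j * p) start T (<⇒≱ (beyond {T} cpKᵀ<Lᵀ))
    in suc t , ≰⇒> ¬below , step {t} below
    where
      start : 1 * q ≤ c * 1 * p
      start = subst₂ _≤_ (sym (*-identityˡ q)) (cong (_* p) (sym (*-identityʳ c))) q≤cp
      beyond : ∀ {T} → c * p * K ^ T < L ^ T → c * K ^ T * p < L ^ T * q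
      beyond {T} cpKᵀ<Lᵀ = let open ≤-Reasoning in begin-strict
        c * K ^ T * p   ≡⟨ xy∙z≈xz∙y c (K ^ T) p ⟩
        c * p * K ^ T   <⟨ cpKᵀ<Lᵀ ⟩
        L ^ T           ≤⟨ m≤m*n (L ^ T) q ⟩
        L ^ T * q       ∎
      step : ∀ {t} → L ^ t * q ≤ c * K ^ t * p → L ^ suc t * Q < c * K ^ suc t * P
      step {t} below = let open ≤-Reasoning in *-cancelʳ-< q _ _ (begin-strict
        L * L ^ t * Q * q          ≡⟨ regroup₁ L (L ^ t) Q q ⟩
        L * Q * (L ^ t * q)        ≤⟨ *-monoʳ-≤ (L * Q) below ⟩
        L * Q * (c * K ^ t * p)    ≡⟨ regroup₂ L Q (c * K ^ t) p ⟩
        c * K ^ t * (L * (p * Q))  <⟨ *-monoʳ-< (c * K ^ t) {{cKᵗ≢0}} LpQ<KPq ⟩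
        c * K ^ t * (K * (P * q))  ≡⟨ regroup₃ c (K ^ t) K P q ⟩
        c * (K * K ^ t) * P * q    ∎)
        where
          cKᵗ≢0 = m*n≢0 c (K ^ t) {{_}} {{m^n≢0 K t}}
          regroup₁ : ∀ l x u v → l * x * u * v ≡ l * u * (x * v)
          regroup₁ = solve-∀
          regroup₂ : ∀ l u y p → l * u * (y * p) ≡ y * (l * (p * u))
          regroup₂ = solve-∀
          regroup₃ : ∀ c x k u v → c * x * (k * (u * v)) ≡ c * (k * x) * u * v
          regroup₃ = solve-∀

  powers-enter : ∀ {x y a b p q P Q} → 1 < x → x ^ b < y ^ a → 0 < p → 0 < q →
    y ^ a * (p * Q) < x ^ b * (P * q) → ∀ M →
    ∃₂ λ m n → M ≤ m × x ^ m * p < y ^ n * q × y ^ n * Q < x ^ m * P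
  powers-enter {x@(suc _)} {y} {a} {b} {p@(suc _)} {q} {P} {Q} 1<x xᵇ<yᵃ 0<p 0<q yᵃpQ<xᵇPq M =
    let j , lower , upper = orbit-enters (m^n>0 x b) xᵇ<yᵃ (m^n>0 x (M + q)) 0<q q≤xᴹ⁺ᑫp yᵃpQ<xᵇPq
    in M + q + b * j , a * j , ≤-trans (m≤m+n M q) (m≤m+n (M + q) (b * j)) ,
       subst₂ (λ X Y → X * p < Y * q) (sym (x^-split j)) (^-*-assoc y a j) lower ,
       subst₂ (λ X Y → Y * Q < X * P) (sym (x^-split j)) (^-*-assoc y a j) upper
    where
      x^-split : ∀ j → x ^ (M + q + b * j) ≡ x ^ (M + q) * (x ^ b) ^ j
      x^-split j = trans (^-distribˡ-+-* x (M + q) (b * j))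
                         (cong (x ^ (M + q) *_) (sym (^-*-assoc x b j)))
      q≤xᴹ⁺ᑫp : q ≤ x ^ (M + q) * p
      q≤xᴹ⁺ᑫp = ≤-trans (m≤n+m q M)
                  (≤-trans (<⇒≤ (n<m^n 1<x (M + q))) (m≤m*n (x ^ (M + q)) p))

  powers-distinct : ∀ {k ℓ a} → MultIndep k ℓ → 1 < ℓ → 0 < a → ∀ b → k ^ b ≢ ℓ ^ a
  powers-distinct {ℓ = ℓ} _ 1<ℓ 0<a zero = <⇒≢ (^-monoʳ-< ℓ 1<ℓ 0<a)
  powers-distinct {a = a} indep _ 0<a (suc b) = indep (suc b) a (s≤s z≤n) 0<a

  density : ∀ {k ℓ} → 1 < k → 1 < ℓ → MultIndep k ℓ →
    ∀ {p q P Q} → 0 < p → 0 < q → 0 < P → 0 < Q → p * Q < P * q → ∀ M →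
    ∃₂ λ m n → M ≤ m + n × k ^ m * p < ℓ ^ n * q × ℓ ^ n * Q < k ^ m * P
  density {k} {ℓ} 1<k 1<ℓ indep {p} {q} {P} {Q} 0<p 0<q 0<P 0<Q pQ<Pq M
    with T , k<ρᵀ ← ^-outgrows-* (*-mono-< 0<p 0<Q) pQ<Pq k
    with a , b , 0<a , ℓᵃpQ<kᵇPq , kᵇpQ<ℓᵃPq ← close-powers {T = T} 1<k 1<ℓ k<ρᵀ
    with <-cmp (k ^ b) (ℓ ^ a)
  ... | tri< kᵇ<ℓᵃ _ _ =
    let m , n , M≤m , lower , upper =
          powers-enter {a = a} {b = b} 1<k kᵇ<ℓᵃ 0<p 0<q ℓᵃpQ<kᵇPq M
    in m , n , ≤-trans M≤m (m≤m+n m n) , lower , upper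
  ... | tri≈ _ kᵇ≡ℓᵃ _ = contradiction kᵇ≡ℓᵃ (powers-distinct indep 1<ℓ 0<a b)
  ... | tri> _ _ ℓᵃ<kᵇ =
    let n , m , M≤n , upper , lower =
          powers-enter {a = b} {b = a} 1<ℓ ℓᵃ<kᵇ 0<Q 0<P
            (subst₂ _<_ (cong (k ^ b *_) (*-comm p Q)) (cong (ℓ ^ a *_) (*-comm P q)) kᵇpQ<ℓᵃPq) M
    in m , n , ≤-trans M≤n (m≤n+m n m) , lower , upper

module LinearForms where

  open import Data.Nat.Base as ℕ using (ℕ; suc)
  import Data.Nat.Properties as ℕ
  open import Data.Integer.Base
    using ( ℤ; +_; -[1+_]; 0ℤ; 1ℤ; _+_; _*_; _≤_; _<_; ∣_∣; +<+; +≤+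
          ; positive; nonNegative; nonPositive)
  open import Data.Integer.Properties
  open import Data.Integer.Tactic.RingSolver using (solve-∀)
  open import Data.Product.Base using (_×_; _,_)
  open import Data.Sum.Base using (inj₁; inj₂)
  open import Relation.Binary.PropositionalEquality

  pos*pos⇒pos : ∀ {i j} → 0ℤ < i → 0ℤ < j → 0ℤ < i * j
  pos*pos⇒pos {i} {j} 0<i 0<j =
    subst (_< i * j) (*-zeroʳ i) (*-monoˡ-<-pos i {{positive 0<i}} 0<j)

  -- q (A x + B y) = x (A q) + B (y q), and B (y q) ≥ B (x p) or B (x P) according to the sign of B.
  positive-between : ∀ A B {x y p q P} → 0ℤ < x → 0ℤ ≤ q → x * p ≤ y * q → y * q ≤ x * P →
    0ℤ < A * q + B * p → 0ℤ < A * q + B * P → 0ℤ < A * x + B * y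
  positive-between A B {x} {y} {p} {q} {P} 0<x 0≤q xp≤yq yq≤xP edge₁ edge₂ =
    *-cancelˡ-<-nonNeg q {{nonNegative 0≤q}}
      (subst (_< q * (A * x + B * y)) (sym (*-zeroʳ q)) q[Ax+By]>0)
    where
      through : ∀ {e} → 0ℤ < A * q + B * e → B * (x * e) ≤ B * (y * q) →
                0ℤ < q * (A * x + B * y)
      through {e} edge Bxe≤Byq = begin-strict
        0ℤ                           <⟨ pos*pos⇒pos 0<x edge ⟩
        x * (A * q + B * e)          ≡⟨ regroup₁ x A q B e ⟩
        x * (A * q) + B * (x * e)    ≤⟨ +-monoʳ-≤ (x * (A * q)) Bxe≤Byq ⟩
        x * (A * q) + B * (y * q)    ≡⟨ regroup₂ x A q B y ⟩
        q * (A * x + B * y)          ∎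
        where
          open ≤-Reasoning
          regroup₁ : ∀ x a q b e → x * (a * q + b * e) ≡ x * (a * q) + b * (x * e)
          regroup₁ = solve-∀
          regroup₂ : ∀ x a q b y → x * (a * q) + b * (y * q) ≡ q * (a * x + b * y)
          regroup₂ = solve-∀
      q[Ax+By]>0 : 0ℤ < q * (A * x + B * y)
      q[Ax+By]>0 with ≤-total 0ℤ B
      ... | inj₁ 0≤B = through edge₁ (*-monoˡ-≤-nonNeg B {{nonNegative 0≤B}} xp≤yq)
      ... | inj₂ B≤0 = through edge₂ (*-monoˡ-≤-nonPos B {{nonPositive B≤0}} yq≤xP)

  0<n+i : ∀ {n i} → ∣ i ∣ ℕ.< n → 0ℤ < + n + i
  0<n+i {n} {+ m} m<n = +<+ (ℕ.<-≤-trans (ℕ.≤-<-trans ℕ.z≤n m<n) (ℕ.m≤m+n n m))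
  0<n+i {n} { -[1+ m ]} m<n = subst (0ℤ <_) (sym (⊖-≥ (ℕ.<⇒≤ m<n))) (+<+ (ℕ.m<n⇒0<n∸m m<n))

  -- With s = A U + B V ≥ 1 the two values are N s and N s + B.
  scaled-edges : ∀ A B {U V} N → 0ℤ < A * + U + B * + V → ∣ B ∣ ℕ.< N →
    0ℤ < A * + (N ℕ.* U) + B * + (N ℕ.* V) × 0ℤ < A * + (N ℕ.* U) + B * + suc (N ℕ.* V)
  scaled-edges A B {U} {V} N 0<s ∣B∣<N =
    subst (0ℤ <_) (trans (regroup₁ A B (+ N) (+ U) (+ V)) (cast (pos-* N V)))
      (pos*pos⇒pos 0<N 0<s) ,
    subst (0ℤ <_) (trans (regroup₂ A B (+ N) (+ U) (+ V)) (cast +[1+NV]))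
      (<-≤-trans (0<n+i {i = B} ∣B∣<N) (+-monoˡ-≤ B N≤Ns))
    where
      s = A * + U + B * + V
      0<N : 0ℤ < + N
      0<N = +<+ (ℕ.≤-<-trans ℕ.z≤n ∣B∣<N)
      N≤Ns : + N ≤ + N * s
      N≤Ns = subst (_≤ + N * s) (*-identityʳ (+ N)) (*-monoˡ-≤-nonNeg (+ N) (i<j⇒suc[i]≤j 0<s))
      +[1+NV] : + suc (N ℕ.* V) ≡ 1ℤ + + N * + V
      +[1+NV] = trans (pos-+ 1 (N ℕ.* V)) (cong (_+_ 1ℤ) (pos-* N V))
      cast : ∀ {v w} → v ≡ w → A * (+ N * + U) + B * w ≡ A * + (N ℕ.* U) + B * v
      cast v≡w = cong₂ (λ u v → A * u + B * v) (sym (pos-* N U)) (sym v≡w)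
      regroup₁ : ∀ a b n u v → n * (a * u + b * v) ≡ a * (n * u) + b * (n * v)
      regroup₁ = solve-∀
      regroup₂ : ∀ a b n u v → n * (a * u + b * v) + b ≡ a * (n * u) + b * (1ℤ + n * v)
      regroup₂ = solve-∀

  window-positive : ∀ A B {U V N X Y} → 0ℤ < A * + U + B * + V → ∣ B ∣ ℕ.< N → 0 ℕ.< X →
    X ℕ.* (N ℕ.* V) ℕ.< Y ℕ.* (N ℕ.* U) → Y ℕ.* (N ℕ.* U) ℕ.< X ℕ.* suc (N ℕ.* V) →
    0ℤ < A * + X + B * + Y
  window-positive A B {U} {V} {N} {X} {Y} 0<s ∣B∣<N 0<X lower upper =
    let edge₁ , edge₂ = scaled-edges A B N 0<s ∣B∣<N
    in positive-between A B (+<+ 0<X) (+≤+ ℕ.z≤n)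
         (cast X (N ℕ.* V) Y (N ℕ.* U) lower) (cast Y (N ℕ.* U) X (suc (N ℕ.* V)) upper)
         edge₁ edge₂
    where
      cast : ∀ a b c d → a ℕ.* b ℕ.< c ℕ.* d → + a * + b ≤ + c * + d
      cast a b c d ab<cd = subst₂ _≤_ (pos-* a b) (pos-* c d) (+≤+ (ℕ.<⇒≤ ab<cd))

module SolutionCone where

  open import Data.Nat.Base using (ℕ; suc; _*_; _<_; z≤n; s≤s)
  open import Data.Nat.Properties using (n<1+n; *-mono-<; ≤-trans; m≤m+n)
  open import Data.Nat.Coprimality using (1-coprimeTo) renaming (sym to coprime-sym)
  open import Data.Integer.Base as ℤ using (ℤ; +_; 0ℤ; ∣_∣)
  import Data.Integer.Properties as ℤ
  open import Data.Integer.Tactic.RingSolver using (solve-∀)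
  open import Data.Rational.Base as ℚ using (ℚ; mkℚ; ↥_; ↧_; ↧ₙ_; toℚᵘ; 0ℚ)
  import Data.Rational.Properties as ℚ
  import Data.Rational.Unnormalised.Base as ℚᵘ
  import Data.Rational.Unnormalised.Properties as ℚᵘ
  open import Data.List.Base using (List; map)
  open import Data.List.Extrema.Nat using (max; xs≤max)
  open import Data.List.Relation.Unary.All as All using (All)
  open import Data.List.Relation.Unary.All.Properties using (map⁻)
  open import Data.Product.Base using (_,_)
  open import Function.Base using (_∘_)
  open import Function.Bundles using (_⇔_; mk⇔; Equivalence)
  open import Relation.Binary.PropositionalEquality
  open import Defs
  open LinearForms using (window-positive)

  xCoeff yCoeff : Ineq → ℤ
  xCoeff (a , b) = ↥ a ℤ.* ↧ b
  yCoeff (a , b) = ↥ b ℤ.* ↧ a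

  Form : Ineq → ℤ → ℤ → ℤ
  Form c X Y = xCoeff c ℤ.* X ℤ.+ yCoeff c ℤ.* Y

  -- Multiply a x + b y by ↧a ↧b ↧x ↧y > 0.
  satisfies⇔ : ∀ c x y → Satisfies c x y ⇔ 0ℤ ℤ.< Form c (↥ x ℤ.* ↧ y) (↥ y ℤ.* ↧ x)
  satisfies⇔ (a@(mkℚ _ _ _) , b@(mkℚ _ _ _)) x@(mkℚ _ _ _) y@(mkℚ _ _ _) = mk⇔
    (λ 0<ax+by → subst (0ℤ ℤ.<_) numerator
                   (ℚᵘ.>0⇒↥>0 (ℚᵘ.<-respʳ-≃ homo (ℚ.toℚᵘ-mono-< 0<ax+by))))
    (λ 0<form → ℚ.toℚᵘ-cancel-< (ℚᵘ.<-respʳ-≃ (ℚᵘ.≃-sym homo)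
                  (ℚᵘ.positive⁻¹ _ {{ℤ.positive (subst (0ℤ ℤ.<_) (sym numerator) 0<form)}})))
    where
      homo : toℚᵘ (a ℚ.* x ℚ.+ b ℚ.* y) ℚᵘ.≃ toℚᵘ a ℚᵘ.* toℚᵘ x ℚᵘ.+ toℚᵘ b ℚᵘ.* toℚᵘ y
      homo = ℚᵘ.≃-trans (ℚ.toℚᵘ-homo-+ (a ℚ.* x) (b ℚ.* y))
                        (ℚᵘ.+-cong (ℚ.toℚᵘ-homo-* a x) (ℚ.toℚᵘ-homo-* b y))
      regroup : ∀ na da nb db nx dx ny dy →
        (na ℤ.* nx) ℤ.* (db ℤ.* dy) ℤ.+ (nb ℤ.* ny) ℤ.* (da ℤ.* dx)
          ≡ (na ℤ.* db) ℤ.* (nx ℤ.* dy) ℤ.+ (nb ℤ.* da) ℤ.* (ny ℤ.* dx)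
      regroup = solve-∀
      numerator = regroup (↥ a) (↧ a) (↥ b) (↧ b) (↥ x) (↧ x) (↥ y) (↧ y)

  toℚ≡mkℚ : ∀ X → toℚ X ≡ mkℚ (+ X) 0 (coprime-sym (1-coprimeTo X))
  toℚ≡mkℚ X = ℚ.normalize-coprime (coprime-sym (1-coprimeTo X))

  satisfies-toℚ : ∀ c {X Y} → 0ℤ ℤ.< Form c (+ X) (+ Y) → Satisfies c (toℚ X) (toℚ Y)
  satisfies-toℚ c {X} {Y} 0<form =
    subst₂ (Satisfies c) (sym (toℚ≡mkℚ X)) (sym (toℚ≡mkℚ Y))
      (Equivalence.from (satisfies⇔ c _ _)
        (subst₂ (λ x y → 0ℤ ℤ.< Form c x y)
          (sym (ℤ.*-identityʳ (+ X))) (sym (ℤ.*-identityʳ (+ Y))) 0<form))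

  ↥-pos : ∀ {x} → 0ℚ ℚ.< x → 0ℤ ℤ.< ↥ x
  ↥-pos {x@(mkℚ _ _ _)} 0<x = ℤ.positive⁻¹ (↥ x) {{ℚ.positive 0<x}}

  +∣↥∣ : ∀ {x} → 0ℚ ℚ.< x → + ∣ ↥ x ∣ ≡ ↥ x
  +∣↥∣ 0<x = ℤ.0≤i⇒+∣i∣≡i (ℤ.<⇒≤ (↥-pos 0<x))

  -- For 0 < x, (ray x y , ray y x) is the integer point (↥x ↧y , ↥y ↧x) on the ray through (x , y).
  ray : ℚ → ℚ → ℕ
  ray x y = ∣ ↥ x ∣ * ↧ₙ y

  +ray : ∀ {x} → 0ℚ ℚ.< x → ∀ y → + ray x y ≡ ↥ x ℤ.* ↧ y
  +ray {x} 0<x y = trans (ℤ.pos-* ∣ ↥ x ∣ (↧ₙ y)) (cong (ℤ._* ↧ y) (+∣↥∣ 0<x))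

  0<ray : ∀ {x} → 0ℚ ℚ.< x → ∀ y → 0 < ray x y
  0<ray 0<x y = *-mono-< (ℤ.drop‿+<+ (subst (0ℤ ℤ.<_) (sym (+∣↥∣ 0<x)) (↥-pos 0<x))) (s≤s z≤n)

  satisfies-ray : ∀ c {x y} → 0ℚ ℚ.< x → 0ℚ ℚ.< y → Satisfies c x y →
                  0ℤ ℤ.< Form c (+ ray x y) (+ ray y x)
  satisfies-ray c {x} {y} 0<x 0<y sat =
    subst₂ (λ X Y → 0ℤ ℤ.< Form c X Y) (sym (+ray 0<x y)) (sym (+ray 0<y x))
      (Equivalence.to (satisfies⇔ c x y) sat)

  record Window (sys : List Ineq) : Set where
    field
      p q P : ℕ
      0<p : 0 < p
      0<q : 0 < q
      p<P : p < P
      solves : ∀ {X Y} → 0 < X → X * p < Y * q → Y * q < X * P → Solves sys (toℚ X) (toℚ Y)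

  window : ∀ {sys u v} → 0ℚ ℚ.< u → 0ℚ ℚ.< v → Solves sys u v → Window sys
  window {sys} {u} {v} 0<u 0<v sol = record
    { p = N * V ; q = N * U ; P = suc (N * V)
    ; 0<p = ≤-trans (0<ray 0<v u) (m≤m+n V _)
    ; 0<q = ≤-trans (0<ray 0<u v) (m≤m+n U _)
    ; p<P = n<1+n (N * V)
    ; solves = λ {X} {Y} 0<X lower upper → All.zipWith
        (λ {c} (sat , ∣B∣<N) → satisfies-toℚ c {X} {Y}
           (window-positive (xCoeff c) (yCoeff c) (satisfies-ray c 0<u 0<v sat)
              ∣B∣<N 0<X lower upper))
        (sol , ∣B∣<N)
    }
    where
      U = ray u v
      V = ray v u
      N = suc (max 0 (map (∣_∣ ∘ yCoeff) sys))
      ∣B∣<N : All (λ c → ∣ yCoeff c ∣ < N) sys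
      ∣B∣<N = All.map s≤s (map⁻ (xs≤max 0 (map (∣_∣ ∘ yCoeff) sys)))

open import Defs
open import Data.Nat using (ℕ; _^_; _≤_)
open import Data.Rational using (ℚ; _<_; 0ℚ)
open import Data.Product using (Σ; ∃; _×_; _,_)
open import Data.List using (List)
open import Data.List.Membership.Propositional using (_∉_)

import Data.Nat as ℕ
import Data.Nat.Properties as ℕ
open import Data.List using (map)
open import Data.List.Extrema.Nat using (max; xs≤max)
open import Data.List.Relation.Unary.All using (lookup)
open import Data.List.Relation.Unary.All.Properties using (map⁻)
open import Data.Product using (uncurry)
open Density using (density; n<m^n)
open SolutionCone using (Window; window)

∉-beyond-max : ∀ {a} {A : Set a} (f : A → ℕ) xs {x} → max 0 (map f xs) ℕ.< f x → x ∉ xs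
∉-beyond-max f xs beyond x∈xs = ℕ.<⇒≱ beyond (lookup (map⁻ (xs≤max 0 (map f xs))) x∈xs)

mainTheorem2 : (k ℓ : ℕ) → 2 ≤ k → 2 ≤ ℓ → MultIndep k ℓ →
    (sys : List Ineq) →
    (Σ ℚ λ u → Σ ℚ λ v → 0ℚ < u × 0ℚ < v × Solves sys u v) →
    (F : List (ℕ × ℕ)) →
    Σ ℕ λ m → Σ ℕ λ n →
      Solves sys (toℚ (k ^ m)) (toℚ (ℓ ^ n)) × (k ^ m , ℓ ^ n) ∉ F
mainTheorem2 k ℓ 1<k 1<ℓ indep sys (u , v , 0<u , 0<v , sol) F =
  let open Window (window 0<u 0<v sol)
      size = uncurry ℕ._+_
      m , n , large , lower , upper =
        density 1<k 1<ℓ indep 0<p 0<q (ℕ.<-trans 0<p p<P) 0<q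
          (ℕ.*-monoˡ-< q {{ℕ.>-nonZero 0<q}} p<P) (max 0 (map size F))
      m<kᵐ = n<m^n 1<k m
      n<ℓⁿ = n<m^n 1<ℓ n
  in m , n , solves {k ^ m} {ℓ ^ n} (ℕ.m<n⇒0<n m<kᵐ) lower upper ,
     ∉-beyond-max size F (ℕ.≤-<-trans large (ℕ.+-mono-< m<kᵐ n<ℓⁿ))
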